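{- Let $q$ be a prime power and let $M$ be a set of points of the projective space ${\rm PG}(4,q)$. Let $P_1,P_2,P_3$ be three non-collinear points such that the plane $\pi$ they span contains no point of $M$. Let $m,n,d$ be positive real numbers such that each of $P_1,P_2,P_3$ lies on at most $nq^2$ lines that meet $M$, $|M|=dq^3$, and $q>32n^5m/d^5$. Then there exists a solid (projective $3$-dimensional subspace) $S$ containing $\pi$ with $|S\cap M|\ge mq^2$.
   Formalization: The parameters m, n and d range over the positive rationals instead of the positive reals. -}

module Defs where

open import Level using (0ℓ)
open import Data.Bool using (Bool; true; false; _∧_; not; if_then_else_)
import Data.Bool.Properties as BoolP
open import Data.Nat as ℕ using (ℕ; zero; suc)
open import Data.Nat.Primality using (Prime)
open import Data.Product using (Σ; ∃; _×_; _,_)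
import Data.List.Properties
open import Data.List using (List; []; _∷_; map; concatMap; filterᵇ; length; deduplicate)
open import Data.Bool.ListAction using (any)
open import Data.List.Membership.Propositional using (_∈_)
open import Data.List.Relation.Unary.Unique.Propositional using (Unique)
open import Data.Vec as Vec using (Vec; []; _∷_; zipWith; replicate)
import Data.Vec.Properties as VecP
open import Data.Integer as ℤ using (+_)
open import Data.Rational as ℚ using (ℚ; _/_)
open import Relation.Nullary using (¬_; Dec; yes; no)
open import Relation.Nullary.Decidable using (⌊_⌋)
open import Relation.Binary.PropositionalEquality using (_≡_)
open import Relation.Binary.Definitions using (DecidableEquality)
open import Algebra.Structures using (IsCommutativeRing)

IsPrimePower : ℕ → Set
IsPrimePower q = Σ ℕ λ p → Σ ℕ λ k → Prime p × (q ≡ p ℕ.^ suc k)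

ℕ→ℚ : ℕ → ℚ
ℕ→ℚ n = (+ n) / 1

infixr 8 _^ℚ_
_^ℚ_ : ℚ → ℕ → ℚ
x ^ℚ zero  = ℚ.1ℚ
x ^ℚ suc k = x ℚ.* (x ^ℚ k)

record FiniteField : Set₁ where
  field
    Carrier : Set
    _+_ _*_ : Carrier → Carrier → Carrier
    -_      : Carrier → Carrier
    0# 1#   : Carrier
    isCommutativeRing : IsCommutativeRing _≡_ _+_ _*_ -_ 0# 1#
    0≢1     : ¬ (0# ≡ 1#)
    inverse : ∀ x → ¬ (x ≡ 0#) → Σ Carrier λ y → x * y ≡ 1#
    _≟_     : DecidableEquality Carrier
    elements : List Carrier
    complete : ∀ x → x ∈ elements
    unique   : Unique elements

  order : ℕ
  order = length elements

-- Vectors of F^5; a point of PG(4,q) is represented by its unique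
-- normalised representative (first non-zero coordinate equal to 1).

module PG (F : FiniteField) where
  open FiniteField F

  Vec5 : Set
  Vec5 = Vec Carrier 5

  _==_ : Carrier → Carrier → Bool
  x == y = ⌊ x ≟ y ⌋

  _==v_ : ∀ {k} → Vec Carrier k → Vec Carrier k → Bool
  u ==v v = ⌊ VecP.≡-dec _≟_ u v ⌋

  allVecs : (k : ℕ) → List (Vec Carrier k)
  allVecs zero    = [] ∷ []
  allVecs (suc k) = concatMap (λ x → map (x ∷_) (allVecs k)) elements

  isNormalised : ∀ {k} → Vec Carrier k → Bool
  isNormalised []       = false
  isNormalised (x ∷ xs) = if x == 0# then isNormalised xs else x == 1#

  isPoint : Vec5 → Bool
  isPoint = isNormalised

  points : List Vec5
  points = filterᵇ isPoint (allVecs 5)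

  zeroV : ∀ {k} → Vec Carrier k
  zeroV = replicate _ 0#

  _+v_ : ∀ {k} → Vec Carrier k → Vec Carrier k → Vec Carrier k
  _+v_ = zipWith _+_

  _·_ : ∀ {k} → Carrier → Vec Carrier k → Vec Carrier k
  a · v = Vec.map (a *_) v

  lincomb : ∀ {j} → Vec Carrier j → Vec Vec5 j → Vec5
  lincomb []       []       = zeroV
  lincomb (a ∷ as) (u ∷ us) = (a · u) +v lincomb as us

  inSpan : ∀ {j} → Vec Vec5 j → Vec5 → Bool
  inSpan {j} us x = any (λ a → lincomb a us ==v x) (allVecs j)

  LinearlyIndependent : ∀ {j} → Vec Vec5 j → Set
  LinearlyIndependent {j} us = ∀ (a : Vec Carrier j) → lincomb a us ≡ zeroV → a ≡ zeroV

  Solid : Set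
  Solid = Σ (Vec Vec5 4) LinearlyIndependent

  Collinear : Vec5 → Vec5 → Vec5 → Set
  Collinear P₁ P₂ P₃ = Σ (Vec Vec5 2) λ uv →
    (inSpan uv P₁ ≡ true) × (inSpan uv P₂ ≡ true) × (inSpan uv P₃ ≡ true)

  -- point set of the line PQ, as a membership vector over the list of points
  lineSet : Vec5 → Vec5 → List Bool
  lineSet P Q = map (inSpan (P ∷ Q ∷ [])) points

  linesThroughMeeting : Vec5 → (Vec5 → Bool) → List (List Bool)
  linesThroughMeeting P M =
    deduplicate (Data.List.Properties.≡-dec BoolP._≟_)
      (map (lineSet P) (filterᵇ (λ Q → M Q ∧ not (Q ==v P)) points))

  #linesThroughMeeting : Vec5 → (Vec5 → Bool) → ℕ
  #linesThroughMeeting P M = length (linesThroughMeeting P M)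

  #M : (Vec5 → Bool) → ℕ
  #M M = length (filterᵇ M points)

  #SolidMeet : Solid → (Vec5 → Bool) → ℕ
  #SolidMeet (us , _) M = length (filterᵇ (λ x → M x ∧ inSpan us x) points)

-- Let N = |M| and let Lᵢ be the number of lines through Pᵢ meeting M; choose t ≥ 1 with
-- (t - 1)(L₁ + L₂ + L₃) < N ≤ t (L₁ + L₂ + L₃). Keep the points of M whose line through P₃
-- carries at least t points of M, then those of them whose line through P₂ carries at least
-- t of the kept points, then likewise for P₁. Round i discards at most (t - 1)Lᵢ points, so a
-- point x survives. Walking from x along lines through P₁, then P₂, then P₃ reaches t³ points
-- of M in the solid ⟨x, P₁, P₂, P₃⟩. They are distinct: in coordinates for the basis
-- (x, P₁, P₂, P₃), the points reached in the first step have vanishing P₂- and P₃-coordinates,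
-- those of the second step a vanishing P₃-coordinate, and a line through a basis vector meets
-- the hyperplane where that coordinate vanishes at most once.
-- Finally N ≤ q L₁ ≤ n q³ gives d ≤ n, and N ≤ 3 n q² t gives d q ≤ 3 n t, so
-- 32 n⁵ m q² < q³ d⁵ = (d q)³ d² ≤ 27 n⁵ t³, i.e. m q² < t³.

module Submission where

open import Defs
open import Data.Bool using (Bool; true)
open import Data.Vec using (_∷_; [])
open import Relation.Nullary using (¬_)
open import Relation.Binary.PropositionalEquality using (_≡_)

module ListCounting where

  open import Data.Bool.Properties using (T-≡)
  open import Data.Nat using (ℕ; suc; _+_; _*_; _≤_; _<_; _≤?_; z≤n; s≤s)
  open import Data.Nat.Properties using (module ≤-Reasoning; ≤-trans; +-mono-≤; +-monoʳ-≤; +-suc; ≮⇒≥)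
  open import Data.List using (List; []; _∷_; length; map; filter; filterᵇ; concatMap)
  open import Data.List.Properties using (length-++; filter-notAll; ∷-injectiveˡ; ∷-injectiveʳ)
  open import Data.List.Membership.Propositional using (_∈_; find)
  open import Data.List.Membership.Propositional.Properties using (∈-filter⁺; ∈-filter⁻; ∈-concatMap⁻)
  open import Data.List.Relation.Unary.Any as Any using (here; there)
  import Data.List.Relation.Unary.All as All
  open import Data.List.Relation.Unary.AllPairs using ([]; _∷_)
  open import Data.List.Relation.Unary.Unique.Propositional using (Unique)
  open import Data.List.Relation.Unary.Unique.Propositional.Properties using (++⁺)
  import Data.List.Relation.Binary.Sublist.Propositional.Properties as Sublist
  open import Data.Product using (∃-syntax; _×_; _,_; proj₁; proj₂)
  open import Function using (_∘_; Equivalence)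
  open import Relation.Nullary using (yes; no; ¬?; contradiction)
  open import Relation.Nullary.Decidable using (T?)
  open import Relation.Unary using (Decidable)
  open import Relation.Binary.Definitions using (DecidableEquality)
  open import Relation.Binary.PropositionalEquality using (_≢_; refl; sym; trans; subst; cong)

  module _ {A : Set} where

    ∈-filterᵇ⁺ : (p : A → Bool) {x : A} {xs : List A} → x ∈ xs → p x ≡ true → x ∈ filterᵇ p xs
    ∈-filterᵇ⁺ p x∈xs px = ∈-filter⁺ (T? ∘ p) x∈xs (Equivalence.from T-≡ px)

    ∈-filterᵇ⁻ : (p : A → Bool) {x : A} {xs : List A} → x ∈ filterᵇ p xs → x ∈ xs × p x ≡ true
    ∈-filterᵇ⁻ p {xs = xs} m with ∈-filter⁻ (T? ∘ p) {xs = xs} m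
    ... | x∈xs , px = x∈xs , Equivalence.to T-≡ px

    length-filter-∁ : {P : A → Set} (P? : Decidable P) (xs : List A) →
      length (filter P? xs) + length (filter (¬? ∘ P?) xs) ≡ length xs
    length-filter-∁ P? [] = refl
    length-filter-∁ P? (x ∷ xs) with P? x
    ... | yes _ = cong suc (length-filter-∁ P? xs)
    ... | no _  = trans (+-suc _ _) (cong suc (length-filter-∁ P? xs))

    length-filter-filter≤ : {P Q : A → Set} (P? : Decidable P) (Q? : Decidable Q) (xs : List A) →
      length (filter P? (filter Q? xs)) ≤ length (filter P? xs)
    length-filter-filter≤ P? Q? xs =
      Sublist.length-mono-≤ (Sublist.filter⁺ P? P? (λ { refl p → p }) (Sublist.filter-⊆ Q? xs))

    map-≡⇒≡ : {B : Set} (f g : A → B) {xs : List A} → map f xs ≡ map g xs → ∀ {x} → x ∈ xs → f x ≡ g x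
    map-≡⇒≡ f g {_ ∷ _} eq (here refl) = ∷-injectiveˡ eq
    map-≡⇒≡ f g {_ ∷ _} eq (there x∈xs) = map-≡⇒≡ f g (∷-injectiveʳ eq) x∈xs

    ∃-∈-of-length>0 : {xs : List A} → 0 < length xs → ∃[ x ] x ∈ xs
    ∃-∈-of-length>0 {x ∷ _} _ = x , here refl

    module _ {B : Set} (_≟_ : DecidableEquality B) where

      length-≤-of-injective-relation : (R : A → B → Set) {xs : List A} {ys : List B} → Unique xs →
        (∀ {x} → x ∈ xs → ∃[ y ] y ∈ ys × R x y) →
        (∀ {x x' y} → x ∈ xs → x' ∈ xs → R x y → R x' y → x ≡ x') →
        length xs ≤ length ys
      length-≤-of-injective-relation R {[]} _ _ _ = z≤n
      length-≤-of-injective-relation R {x ∷ xs} {ys} (x∉xs ∷ unique) image injective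
        with image (here refl)
      ... | y₀ , y₀∈ys , Rxy₀ = ≤-trans (s≤s (length-≤-of-injective-relation R unique image′ injective′))
                                        (filter-notAll (¬? ∘ (y₀ ≟_)) ys (Any.map (λ y₀≡y y₀≢y → y₀≢y y₀≡y) y₀∈ys))
        where
        image′ : ∀ {x'} → x' ∈ xs → ∃[ y ] y ∈ filter (¬? ∘ (y₀ ≟_)) ys × R x' y
        image′ x'∈xs with image (there x'∈xs)
        ... | y , y∈ys , Rx'y = y , ∈-filter⁺ (¬? ∘ (y₀ ≟_)) y∈ys y₀≢y , Rx'y
          where
          y₀≢y : y₀ ≢ y
          y₀≢y refl = All.lookup x∉xs x'∈xs (injective (here refl) (there x'∈xs) Rxy₀ Rx'y)
        injective′ : ∀ {x x' y} → x ∈ xs → x' ∈ xs → R x y → R x' y → x ≡ x'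
        injective′ m m' = injective (there m) (there m')

    module _ (_≟_ : DecidableEquality A) where

      Unique-⊆⇒length-≤ : {xs ys : List A} → Unique xs → (∀ {x} → x ∈ xs → x ∈ ys) → length xs ≤ length ys
      Unique-⊆⇒length-≤ unique xs⊆ys =
        length-≤-of-injective-relation _≟_ _≡_ unique (λ {x} x∈xs → x , xs⊆ys x∈xs , refl) (λ { _ _ refl refl → refl })

    module _ {B : Set} (g : A → List B) where

      length-concatMap-≥ : (c : ℕ) (xs : List A) → (∀ {x} → x ∈ xs → c ≤ length (g x)) →
        length xs * c ≤ length (concatMap g xs)
      length-concatMap-≥ c [] _ = z≤n
      length-concatMap-≥ c (x ∷ xs) large =
        subst (_ ≤_) (sym (length-++ (g x)))
          (+-mono-≤ (large (here refl)) (length-concatMap-≥ c xs (large ∘ there)))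

      Unique-concatMap : {xs : List A} → Unique xs → (∀ {x} → x ∈ xs → Unique (g x)) →
        (∀ {x x' w} → x ∈ xs → x' ∈ xs → w ∈ g x → w ∈ g x' → x ≡ x') →
        Unique (concatMap g xs)
      Unique-concatMap {[]} _ _ _ = []
      Unique-concatMap {x ∷ xs} (x∉xs ∷ unique) unique-g separated =
        ++⁺ (unique-g (here refl))
            (Unique-concatMap unique (unique-g ∘ there) (λ m m' → separated (there m) (there m')))
            disjoint
        where
        disjoint : ∀ {w} → ¬ (w ∈ g x × w ∈ concatMap g xs)
        disjoint (w∈gx , w∈rest) with find (∈-concatMap⁻ g {xs = xs} w∈rest)
        ... | x' , x'∈xs , w∈gx' = All.lookup x∉xs x'∈xs (separated (here refl) (there x'∈xs) w∈gx w∈gx')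

  module _ {A K : Set} (_≟_ : DecidableEquality K) (f : A → K) where

    fibre : List A → K → List A
    fibre xs k = filter (λ x → f x ≟ k) xs

    rich : ℕ → List A → List A
    rich t xs = filter (λ x → t ≤? length (fibre xs (f x))) xs

    ∈-fibre⁻ : ∀ {xs k x} → x ∈ fibre xs k → x ∈ xs × f x ≡ k
    ∈-fibre⁻ {xs} {k} = ∈-filter⁻ (λ x → f x ≟ k) {xs = xs}

    ∈-rich⁻ : ∀ {t xs x} → x ∈ rich t xs → x ∈ xs × t ≤ length (fibre xs (f x))
    ∈-rich⁻ {t} {xs} = ∈-filter⁻ (λ x → t ≤? length (fibre xs (f x))) {xs = xs}

    length-≤-keys*fibre : (ks : List K) (b : ℕ) {xs : List A} →
      (∀ {x} → x ∈ xs → f x ∈ ks) → (∀ {x} → x ∈ xs → length (fibre xs (f x)) ≤ b) →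
      length xs ≤ length ks * b
    length-≤-keys*fibre [] b {[]} _ _ = z≤n
    length-≤-keys*fibre [] b {x ∷ _} keys _ with keys (here refl)
    ... | ()
    length-≤-keys*fibre (k ∷ ks) b {xs} keys bounded = begin
      length xs                                   ≡⟨ sym (length-filter-∁ (λ x → f x ≟ k) xs) ⟩
      length (fibre xs k) + length rest           ≤⟨ +-mono-≤ (bounded-at k) (length-≤-keys*fibre ks b keys′ bounded′) ⟩
      b + length ks * b                           ∎
      where
      open ≤-Reasoning
      rest : List A
      rest = filter (¬? ∘ (λ x → f x ≟ k)) xs
      bounded-at : ∀ k′ → length (fibre xs k′) ≤ b
      bounded-at k′ with fibre xs k′ in eq
      ... | [] = z≤n
      ... | x ∷ _ with ∈-fibre⁻ {xs} {k′} (subst (x ∈_) (sym eq) (here refl))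
      ...   | x∈xs , refl = subst (λ l → length l ≤ b) eq (bounded x∈xs)
      keys′ : ∀ {x} → x ∈ rest → f x ∈ ks
      keys′ {x} x∈rest with ∈-filter⁻ (¬? ∘ (λ x → f x ≟ k)) {xs = xs} x∈rest
      ... | x∈xs , fx≢k with keys x∈xs
      ...   | here fx≡k = contradiction fx≡k fx≢k
      ...   | there fx∈ks = fx∈ks
      bounded′ : ∀ {x} → x ∈ rest → length (fibre rest (f x)) ≤ b
      bounded′ {x} x∈rest = ≤-trans (length-filter-filter≤ (λ y → f y ≟ f x) (¬? ∘ (λ x → f x ≟ k)) xs)
                                    (bounded (proj₁ (∈-filter⁻ (¬? ∘ (λ x → f x ≟ k)) {xs = xs} x∈rest)))

    length-≤-rich+keys* : (ks : List K) (s : ℕ) (xs : List A) → (∀ {x} → x ∈ xs → f x ∈ ks) →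
      length xs ≤ length (rich (suc s) xs) + length ks * s
    length-≤-rich+keys* ks s xs keys = begin
      length xs                                 ≡⟨ sym (length-filter-∁ rich? xs) ⟩
      length (rich (suc s) xs) + length poor    ≤⟨ +-monoʳ-≤ _ (length-≤-keys*fibre ks s (keys ∘ poor⊆xs) bounded) ⟩
      length (rich (suc s) xs) + length ks * s  ∎
      where
      open ≤-Reasoning
      rich? = λ x → suc s ≤? length (fibre xs (f x))
      poor : List A
      poor = filter (¬? ∘ rich?) xs
      poor⊆xs : ∀ {x} → x ∈ poor → x ∈ xs
      poor⊆xs = proj₁ ∘ ∈-filter⁻ (¬? ∘ rich?) {xs = xs}
      bounded : ∀ {x} → x ∈ poor → length (fibre poor (f x)) ≤ s
      bounded {x} x∈poor = ≤-trans (length-filter-filter≤ (λ y → f y ≟ f x) (¬? ∘ rich?) xs)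
                                   (≮⇒≥ (proj₂ (∈-filter⁻ (¬? ∘ rich?) {xs = xs} x∈poor)))

    fibres-disjoint : ∀ {xs xs' k k' w} → w ∈ fibre xs k → w ∈ fibre xs' k' → k ≡ k'
    fibres-disjoint {xs} {xs'} w∈fibre w∈fibre′ =
      trans (sym (proj₂ (∈-fibre⁻ {xs} w∈fibre))) (proj₂ (∈-fibre⁻ {xs'} w∈fibre′))

module RationalArithmetic where

  open import Data.Nat as ℕ using (ℕ; suc)
  import Data.Nat.Properties as ℕ
  open import Data.Nat.DivMod using (_/_; _%_; m≡m%n+[m/n]*n; m%n<n; m/n*n≤m)
  open import Data.Nat.Coprimality using (1-coprimeTo)
  import Data.Nat.Coprimality as Coprime
  open import Data.Integer as ℤ using (+_)
  import Data.Integer.Properties as ℤ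
  open import Data.Rational as ℚ using (ℚ; _≤_; _<_; _*_; _+_; Positive; NonNegative; mkℚ; 0ℚ; 1ℚ)
  open import Data.Rational.Properties
  open import Data.Rational.Solver using (module +-*-Solver)
  open +-*-Solver using (solve; _:+_; _:*_; _:=_; con)
  open import Data.Product using (∃-syntax; _×_; _,_)
  open import Relation.Nullary using (contradiction)
  open import Relation.Binary.PropositionalEquality using (refl; sym; trans; cong; cong₂; subst; subst₂)

  ℕ→ℚ≡mkℚ : ∀ n → ℕ→ℚ n ≡ mkℚ (+ n) 0 (Coprime.sym (1-coprimeTo n))
  ℕ→ℚ≡mkℚ n = normalize-coprime (Coprime.sym (1-coprimeTo n))

  ℕ→ℚ-+ : ∀ a b → ℕ→ℚ (a ℕ.+ b) ≡ ℕ→ℚ a + ℕ→ℚ b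
  ℕ→ℚ-+ a b = sym (trans (cong₂ _+_ (ℕ→ℚ≡mkℚ a) (ℕ→ℚ≡mkℚ b))
    (cong (λ z → z ℚ./ 1) (cong₂ ℤ._+_ (ℤ.*-identityʳ (+ a)) (ℤ.*-identityʳ (+ b)))))

  ℕ→ℚ-* : ∀ a b → ℕ→ℚ (a ℕ.* b) ≡ ℕ→ℚ a * ℕ→ℚ b
  ℕ→ℚ-* a b = sym (trans (cong₂ _*_ (ℕ→ℚ≡mkℚ a) (ℕ→ℚ≡mkℚ b))
    (cong (λ z → z ℚ./ 1) (sym (ℤ.pos-* a b))))

  ℕ→ℚ-mono-≤ : ∀ {a b} → a ℕ.≤ b → ℕ→ℚ a ≤ ℕ→ℚ b
  ℕ→ℚ-mono-≤ {a} {b} a≤b rewrite ℕ→ℚ≡mkℚ a | ℕ→ℚ≡mkℚ b =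
    ℚ.*≤* (subst₂ ℤ._≤_ (sym (ℤ.*-identityʳ (+ a))) (sym (ℤ.*-identityʳ (+ b))) (ℤ.+≤+ a≤b))

  ℕ→ℚ-mono-≤-* : ∀ {a b c} → a ℕ.≤ b ℕ.* c → ℕ→ℚ a ≤ ℕ→ℚ b * ℕ→ℚ c
  ℕ→ℚ-mono-≤-* {b = b} {c} a≤bc = subst (_ ≤_) (ℕ→ℚ-* b c) (ℕ→ℚ-mono-≤ a≤bc)

  ℕ→ℚ-nonNeg : ∀ n → NonNegative (ℕ→ℚ n)
  ℕ→ℚ-nonNeg n rewrite ℕ→ℚ≡mkℚ n = _

  ℕ→ℚ-pos : ∀ n → Positive (ℕ→ℚ (suc n))
  ℕ→ℚ-pos n rewrite ℕ→ℚ≡mkℚ (suc n) = _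

  *-mono-≤-nonNeg : ∀ {a b c e} → NonNegative a → NonNegative c → a ≤ b → c ≤ e → a * c ≤ b * e
  *-mono-≤-nonNeg {a} {b} {c} {e} a≥0 c≥0 a≤b c≤e = ≤-trans (*-monoʳ-≤-nonNeg c {{c≥0}} a≤b)
    (*-monoˡ-≤-nonNeg b {{ℚ.nonNegative (≤-trans (nonNegative⁻¹ a {{a≥0}}) a≤b)}} c≤e)

  square-nonNeg : ∀ a → NonNegative a → NonNegative (a * a)
  square-nonNeg a a≥0 = nonNeg*nonNeg⇒nonNeg a {{a≥0}} a {{a≥0}}

  cube-nonNeg : ∀ a → NonNegative a → NonNegative (a * (a * a))
  cube-nonNeg a a≥0 = nonNeg*nonNeg⇒nonNeg a {{a≥0}} (a * a) {{square-nonNeg a a≥0}}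

  cube-mono-≤ : ∀ a {b} → NonNegative a → a ≤ b → a * (a * a) ≤ b * (b * b)
  cube-mono-≤ a a≥0 a≤b = *-mono-≤-nonNeg a≥0 (square-nonNeg a a≥0) a≤b (*-mono-≤-nonNeg a≥0 a≥0 a≤b a≤b)

  ^ℚ-pos : ∀ p .{{_ : Positive p}} k → Positive (p ^ℚ k)
  ^ℚ-pos p ℕ.zero = _
  ^ℚ-pos p (suc k) = pos*pos⇒pos p (p ^ℚ k) {{^ℚ-pos p k}}

  -- The solver sees x ^ℚ k through its unfolding x * (⋯ * (x * 1ℚ)), hence the con 1ℚ below.
  module DensityBounds (N L₁ L₂ L₃ q : ℕ) (n d : ℚ) .{{_ : Positive (ℕ→ℚ q)}}
    (N≡dq³ : ℕ→ℚ N ≡ d * ℕ→ℚ q ^ℚ 3) (L₁≤nq² : ℕ→ℚ L₁ ≤ n * ℕ→ℚ q ^ℚ 2)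
    (L₂≤nq² : ℕ→ℚ L₂ ≤ n * ℕ→ℚ q ^ℚ 2) (L₃≤nq² : ℕ→ℚ L₃ ≤ n * ℕ→ℚ q ^ℚ 2) where

    private
      Q = ℕ→ℚ q

    density≤n : N ℕ.≤ L₁ ℕ.* q → d ≤ n
    density≤n N≤L₁q = *-cancelʳ-≤-pos (Q ^ℚ 3) {{^ℚ-pos Q 3}} (begin
      d * Q ^ℚ 3        ≡⟨ sym N≡dq³ ⟩
      ℕ→ℚ N             ≤⟨ ℕ→ℚ-mono-≤-* {b = L₁} {q} N≤L₁q ⟩
      ℕ→ℚ L₁ * Q        ≤⟨ *-monoʳ-≤-nonNeg Q {{pos⇒nonNeg Q}} L₁≤nq² ⟩
      n * Q ^ℚ 2 * Q    ≡⟨ solve 2 (λ n q → n :* (q :* (q :* con 1ℚ)) :* q := n :* (q :* (q :* (q :* con 1ℚ)))) refl n Q ⟩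
      n * Q ^ℚ 3        ∎)
      where open ≤-Reasoning

    density*q≤3nt : ∀ t → N ℕ.≤ (L₁ ℕ.+ (L₂ ℕ.+ L₃)) ℕ.* t → d * Q ≤ ℕ→ℚ 3 * n * ℕ→ℚ t
    density*q≤3nt t N≤Lt = *-cancelʳ-≤-pos (Q ^ℚ 2) {{^ℚ-pos Q 2}} (begin
      d * Q * Q ^ℚ 2                                  ≡⟨ solve 2 (λ d q → d :* q :* (q :* (q :* con 1ℚ)) := d :* (q :* (q :* (q :* con 1ℚ)))) refl d Q ⟩
      d * Q ^ℚ 3                                      ≡⟨ sym N≡dq³ ⟩
      ℕ→ℚ N                                           ≤⟨ ℕ→ℚ-mono-≤-* {b = L₁ ℕ.+ (L₂ ℕ.+ L₃)} {t} N≤Lt ⟩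
      ℕ→ℚ (L₁ ℕ.+ (L₂ ℕ.+ L₃)) * T                    ≡⟨ cong (_* T) (trans (ℕ→ℚ-+ L₁ _) (cong (_+_ (ℕ→ℚ L₁)) (ℕ→ℚ-+ L₂ L₃))) ⟩
      (ℕ→ℚ L₁ + (ℕ→ℚ L₂ + ℕ→ℚ L₃)) * T                ≤⟨ *-monoʳ-≤-nonNeg T {{ℕ→ℚ-nonNeg t}} (+-mono-≤ L₁≤nq² (+-mono-≤ L₂≤nq² L₃≤nq²)) ⟩
      (n * Q ^ℚ 2 + (n * Q ^ℚ 2 + n * Q ^ℚ 2)) * T    ≡⟨ solve 3 (λ t n q → (n :* (q :* (q :* con 1ℚ)) :+ (n :* (q :* (q :* con 1ℚ)) :+ n :* (q :* (q :* con 1ℚ)))) :* t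
                                                             := con (ℕ→ℚ 3) :* n :* t :* (q :* (q :* con 1ℚ))) refl T n Q ⟩
      ℕ→ℚ 3 * n * T * Q ^ℚ 2                          ∎)
      where
      open ≤-Reasoning
      T = ℕ→ℚ t

  m*q²<t³ : ∀ (m n d q t : ℚ) .{{_ : Positive n}} .{{_ : Positive d}} .{{_ : Positive q}} → NonNegative t →
    d ≤ n → d * q ≤ ℕ→ℚ 3 * n * t → ℕ→ℚ 32 * n ^ℚ 5 * m < q * d ^ℚ 5 → m * q ^ℚ 2 < t * (t * t)
  m*q²<t³ m n d q t t≥0 d≤n dq≤3nt 32n⁵m<qd⁵ =
    *-cancelˡ-<-nonNeg (ℕ→ℚ 32 * n ^ℚ 5) {{nonNeg*nonNeg⇒nonNeg (ℕ→ℚ 32) {{ℕ→ℚ-nonNeg 32}} (n ^ℚ 5) {{n⁵≥0}}}} (begin-strict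
    ℕ→ℚ 32 * n ^ℚ 5 * (m * q ^ℚ 2)               ≡⟨ sym (*-assoc (ℕ→ℚ 32 * n ^ℚ 5) m (q ^ℚ 2)) ⟩
    ℕ→ℚ 32 * n ^ℚ 5 * m * q ^ℚ 2                 <⟨ *-monoˡ-<-pos (q ^ℚ 2) {{^ℚ-pos q 2}} 32n⁵m<qd⁵ ⟩
    q * d ^ℚ 5 * q ^ℚ 2                          ≡⟨ solve 2 (λ d q → q :* (d :* (d :* (d :* (d :* (d :* con 1ℚ))))) :* (q :* (q :* con 1ℚ))
                                                            := (d :* q) :* ((d :* q) :* (d :* q)) :* (d :* d)) refl d q ⟩
    dq * (dq * dq) * (d * d)                     ≤⟨ *-mono-≤-nonNeg (cube-nonNeg dq dq≥0) (square-nonNeg d d≥0) (cube-mono-≤ dq dq≥0 dq≤3nt) (*-mono-≤-nonNeg d≥0 d≥0 d≤n d≤n) ⟩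
    3nt * (3nt * 3nt) * (n * n)                  ≡⟨ solve 3 (λ n t c → (c :* n :* t) :* ((c :* n :* t) :* (c :* n :* t)) :* (n :* n)
                                                            := c :* c :* c :* (n :* (n :* (n :* (n :* (n :* con 1ℚ)))) :* (t :* (t :* t)))) refl n t (ℕ→ℚ 3) ⟩
    ℕ→ℚ 27 * (n ^ℚ 5 * (t * (t * t)))            ≤⟨ *-monoʳ-≤-nonNeg (n ^ℚ 5 * (t * (t * t))) {{n⁵t³≥0}} (ℕ→ℚ-mono-≤ (ℕ.m≤m+n 27 5)) ⟩
    ℕ→ℚ 32 * (n ^ℚ 5 * (t * (t * t)))            ≡⟨ sym (*-assoc (ℕ→ℚ 32) (n ^ℚ 5) _) ⟩
    ℕ→ℚ 32 * n ^ℚ 5 * (t * (t * t))              ∎)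
    where
    open ≤-Reasoning
    dq = d * q
    3nt = ℕ→ℚ 3 * n * t
    d≥0 : NonNegative d
    d≥0 = pos⇒nonNeg d
    dq≥0 : NonNegative dq
    dq≥0 = pos⇒nonNeg dq {{pos*pos⇒pos d q}}
    n⁵≥0 : NonNegative (n ^ℚ 5)
    n⁵≥0 = pos⇒nonNeg (n ^ℚ 5) {{^ℚ-pos n 5}}
    n⁵t³≥0 : NonNegative (n ^ℚ 5 * (t * (t * t)))
    n⁵t³≥0 = nonNeg*nonNeg⇒nonNeg (n ^ℚ 5) {{n⁵≥0}} (t * (t * t)) {{cube-nonNeg t t≥0}}

  ∃-bracketing-multiple : ∀ N S .{{_ : ℕ.NonZero S}} → 1 ℕ.≤ N → ∃[ s ] S ℕ.* s ℕ.< N × N ℕ.≤ S ℕ.* suc s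
  ∃-bracketing-multiple (suc N) S _ =
    N / S , ℕ.s≤s (ℕ.≤-trans (ℕ.≤-reflexive (ℕ.*-comm S (N / S))) (m/n*n≤m N S)) , (begin
    suc N                          ≡⟨ cong suc (m≡m%n+[m/n]*n N S) ⟩
    suc (N % S ℕ.+ N / S ℕ.* S)    ≤⟨ ℕ.+-monoˡ-≤ (N / S ℕ.* S) (m%n<n N S) ⟩
    S ℕ.+ N / S ℕ.* S              ≡⟨ cong (S ℕ.+_) (ℕ.*-comm (N / S) S) ⟩
    S ℕ.+ S ℕ.* (N / S)            ≡⟨ sym (ℕ.*-suc S (N / S)) ⟩
    S ℕ.* suc (N / S)              ∎)
    where open ℕ.≤-Reasoning

  ℕ→ℚ≡pos⇒≥1 : ∀ N (x : ℚ) .{{_ : Positive x}} → ℕ→ℚ N ≡ x → 1 ℕ.≤ N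
  ℕ→ℚ≡pos⇒≥1 ℕ.zero x 0≡x = contradiction (subst (0ℚ <_) (sym 0≡x) (positive⁻¹ x)) (<-irrefl refl)
  ℕ→ℚ≡pos⇒≥1 (suc N) x _ = ℕ.s≤s ℕ.z≤n

  ℕ→ℚ-cube : ∀ t → ℕ→ℚ (t ℕ.* (t ℕ.* t)) ≡ ℕ→ℚ t * (ℕ→ℚ t * ℕ→ℚ t)
  ℕ→ℚ-cube t = trans (ℕ→ℚ-* t _) (cong (ℕ→ℚ t *_) (ℕ→ℚ-* t t))

module ProjectiveSpace (F : FiniteField) where

  import Data.Bool.Properties as Bool
  open import Data.Bool.Properties using (T-≡)
  open import Data.Nat using (zero; suc; _≤_)
  open import Data.Fin using (Fin; zero; suc)
  open import Data.List using (List; map; length)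
  open import Data.List.Properties using (≡-dec)
  open import Data.List.Membership.Propositional using (_∈_; find; lose)
  open import Data.List.Membership.Propositional.Properties using (∈-concatMap⁺; ∈-map⁺; ∈-map⁻)
  open import Data.List.Relation.Unary.Any using (here)
  open import Data.List.Relation.Unary.Any.Properties using (any⁺; any⁻)
  open import Data.List.Relation.Unary.All using ([])
  open import Data.List.Relation.Unary.AllPairs using ([]; _∷_)
  open import Data.List.Relation.Unary.Unique.Propositional using (Unique)
  open import Data.List.Relation.Unary.Unique.Propositional.Properties using (map⁺; filter⁺)
  open import Data.Vec using (Vec; lookup)
  open import Data.Vec.Properties
    using (lookup-zipWith; lookup-map; lookup-replicate; ∷-injectiveˡ; ∷-injectiveʳ;
           zipWith-assoc; zipWith-comm; zipWith-identityˡ; zipWith-identityʳ)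
  open import Data.Sum using (_⊎_; inj₁; inj₂)
  open import Data.Product using (∃-syntax; _×_; _,_; proj₁; proj₂)
  open import Data.Empty using (⊥-elim)
  open import Function using (_∘_; Equivalence)
  open import Relation.Nullary using (yes; no)
  open import Relation.Nullary.Decidable using (T?; toWitness; fromWitness)
  open import Relation.Binary.Definitions using (DecidableEquality)
  open import Relation.Binary.PropositionalEquality using (_≢_; refl; sym; trans; cong; cong₂; module ≡-Reasoning)
  open import Algebra.Structures using (IsCommutativeRing)
  open ListCounting

  open FiniteField F
  open PG F
  open IsCommutativeRing isCommutativeRing
    using (+-assoc; +-comm; *-assoc; *-comm; +-identityˡ; +-identityʳ; *-identityˡ; *-identityʳ; zeroˡ; zeroʳ; distribˡ; distribʳ; -‿inverseˡ)
  open ≡-Reasoning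

  +v-assoc : ∀ {k} (u v w : Vec Carrier k) → (u +v v) +v w ≡ u +v (v +v w)
  +v-assoc = zipWith-assoc +-assoc

  +v-comm : ∀ {k} (u v : Vec Carrier k) → u +v v ≡ v +v u
  +v-comm = zipWith-comm +-comm

  +v-identityˡ : ∀ {k} (u : Vec Carrier k) → zeroV +v u ≡ u
  +v-identityˡ = zipWith-identityˡ +-identityˡ

  +v-identityʳ : ∀ {k} (u : Vec Carrier k) → u +v zeroV ≡ u
  +v-identityʳ = zipWith-identityʳ +-identityʳ

  ·-distribˡ-+v : ∀ {k} a (u v : Vec Carrier k) → a · (u +v v) ≡ (a · u) +v (a · v)
  ·-distribˡ-+v a [] [] = refl
  ·-distribˡ-+v a (x ∷ u) (y ∷ v) = cong₂ _∷_ (distribˡ a x y) (·-distribˡ-+v a u v)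

  ·-distribʳ-+ : ∀ {k} a b (u : Vec Carrier k) → (a + b) · u ≡ (a · u) +v (b · u)
  ·-distribʳ-+ a b [] = refl
  ·-distribʳ-+ a b (x ∷ u) = cong₂ _∷_ (distribʳ x a b) (·-distribʳ-+ a b u)

  ·-assoc : ∀ {k} a b (u : Vec Carrier k) → a · (b · u) ≡ (a * b) · u
  ·-assoc a b [] = refl
  ·-assoc a b (x ∷ u) = cong₂ _∷_ (sym (*-assoc a b x)) (·-assoc a b u)

  ·-zeroˡ : ∀ {k} (u : Vec Carrier k) → 0# · u ≡ zeroV
  ·-zeroˡ [] = refl
  ·-zeroˡ (x ∷ u) = cong₂ _∷_ (zeroˡ x) (·-zeroˡ u)

  ·-zeroʳ : ∀ {k} a → a · zeroV {k} ≡ zeroV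
  ·-zeroʳ {zero} a = refl
  ·-zeroʳ {suc k} a = cong₂ _∷_ (zeroʳ a) (·-zeroʳ a)

  ·-identityˡ : ∀ {k} (u : Vec Carrier k) → 1# · u ≡ u
  ·-identityˡ [] = refl
  ·-identityˡ (x ∷ u) = cong₂ _∷_ (*-identityˡ x) (·-identityˡ u)

  +v-inverseˡ : ∀ {k} (u : Vec Carrier k) → ((- 1#) · u) +v u ≡ zeroV
  +v-inverseˡ u = begin
    ((- 1#) · u) +v u           ≡⟨ cong (((- 1#) · u) +v_) (sym (·-identityˡ u)) ⟩
    ((- 1#) · u) +v (1# · u)    ≡⟨ sym (·-distribʳ-+ (- 1#) 1# u) ⟩
    ((- 1#) + 1#) · u           ≡⟨ cong (_· u) (-‿inverseˡ 1#) ⟩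
    0# · u                      ≡⟨ ·-zeroˡ u ⟩
    zeroV                       ∎

  +v-inverseʳ : ∀ {k} (u : Vec Carrier k) → u +v ((- 1#) · u) ≡ zeroV
  +v-inverseʳ u = trans (+v-comm u _) (+v-inverseˡ u)

  +v-≡0⇒≡-neg : ∀ {k} (u v : Vec Carrier k) → u +v v ≡ zeroV → u ≡ (- 1#) · v
  +v-≡0⇒≡-neg u v u+v≡0 = begin
    u                                 ≡⟨ sym (+v-identityʳ u) ⟩
    u +v zeroV                        ≡⟨ cong (u +v_) (sym (+v-inverseʳ v)) ⟩
    u +v (v +v ((- 1#) · v))          ≡⟨ sym (+v-assoc u v _) ⟩
    (u +v v) +v ((- 1#) · v)          ≡⟨ cong (_+v ((- 1#) · v)) u+v≡0 ⟩
    zeroV +v ((- 1#) · v)             ≡⟨ +v-identityˡ _ ⟩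
    (- 1#) · v                        ∎

  +v-neg-≡0⇒≡ : ∀ {k} (u v : Vec Carrier k) → u +v ((- 1#) · v) ≡ zeroV → u ≡ v
  +v-neg-≡0⇒≡ u v u-v≡0 = begin
    u                                 ≡⟨ sym (+v-identityʳ u) ⟩
    u +v zeroV                        ≡⟨ cong (u +v_) (sym (+v-inverseˡ v)) ⟩
    u +v (((- 1#) · v) +v v)          ≡⟨ sym (+v-assoc u _ v) ⟩
    (u +v ((- 1#) · v)) +v v          ≡⟨ cong (_+v v) u-v≡0 ⟩
    zeroV +v v                        ≡⟨ +v-identityˡ v ⟩
    v                                 ∎

  lincomb-zero : ∀ {j} (us : Vec Vec5 j) → lincomb zeroV us ≡ zeroV
  lincomb-zero [] = refl
  lincomb-zero (u ∷ us) = trans (cong₂ _+v_ (·-zeroˡ u) (lincomb-zero us)) (+v-identityˡ zeroV)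

  lincomb-+ : ∀ {j} (a b : Vec Carrier j) (us : Vec Vec5 j) →
    lincomb (a +v b) us ≡ lincomb a us +v lincomb b us
  lincomb-+ [] [] [] = sym (+v-identityˡ zeroV)
  lincomb-+ (x ∷ a) (y ∷ b) (u ∷ us) = begin
    ((x + y) · u) +v lincomb (a +v b) us                        ≡⟨ cong₂ _+v_ (·-distribʳ-+ x y u) (lincomb-+ a b us) ⟩
    ((x · u) +v (y · u)) +v (lincomb a us +v lincomb b us)      ≡⟨ +v-interchange (x · u) (y · u) _ _ ⟩
    ((x · u) +v lincomb a us) +v ((y · u) +v lincomb b us)      ∎
    where
    +v-interchange : ∀ {k} (p q r s : Vec Carrier k) → (p +v q) +v (r +v s) ≡ (p +v r) +v (q +v s)
    +v-interchange p q r s = begin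
      (p +v q) +v (r +v s)    ≡⟨ +v-assoc p q _ ⟩
      p +v (q +v (r +v s))    ≡⟨ cong (p +v_) (sym (+v-assoc q r s)) ⟩
      p +v ((q +v r) +v s)    ≡⟨ cong (λ v → p +v (v +v s)) (+v-comm q r) ⟩
      p +v ((r +v q) +v s)    ≡⟨ cong (p +v_) (+v-assoc r q s) ⟩
      p +v (r +v (q +v s))    ≡⟨ sym (+v-assoc p r _) ⟩
      (p +v r) +v (q +v s)    ∎

  lincomb-· : ∀ {j} c (a : Vec Carrier j) (us : Vec Vec5 j) → lincomb (c · a) us ≡ c · lincomb a us
  lincomb-· c [] [] = sym (·-zeroʳ c)
  lincomb-· c (x ∷ a) (u ∷ us) = begin
    ((c * x) · u) +v lincomb (c · a) us      ≡⟨ cong₂ _+v_ (sym (·-assoc c x u)) (lincomb-· c a us) ⟩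
    (c · (x · u)) +v (c · lincomb a us)      ≡⟨ sym (·-distribˡ-+v c _ _) ⟩
    c · ((x · u) +v lincomb a us)            ∎

  lincomb-combination : ∀ {j} α β (a b : Vec Carrier j) (us : Vec Vec5 j) →
    lincomb ((α · a) +v (β · b)) us ≡ (α · lincomb a us) +v (β · lincomb b us)
  lincomb-combination α β a b us =
    trans (lincomb-+ (α · a) (β · b) us) (cong₂ _+v_ (lincomb-· α a us) (lincomb-· β b us))

  lincomb-pair : ∀ α β (u v : Vec5) → lincomb (α ∷ β ∷ []) (u ∷ v ∷ []) ≡ (α · u) +v (β · v)
  lincomb-pair α β u v = cong ((α · u) +v_) (+v-identityʳ (β · v))

  unit : ∀ {j} → Fin j → Vec Carrier j
  unit zero    = 1# ∷ zeroV
  unit (suc i) = 0# ∷ unit i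

  lincomb-unit : ∀ {j} (i : Fin j) (us : Vec Vec5 j) → lincomb (unit i) us ≡ lookup us i
  lincomb-unit zero (u ∷ us) = trans (cong₂ _+v_ (·-identityˡ u) (lincomb-zero us)) (+v-identityʳ u)
  lincomb-unit (suc i) (u ∷ us) = trans (cong₂ _+v_ (·-zeroˡ u) (lincomb-unit i us)) (+v-identityˡ _)

  lookup-unit : ∀ {j} (i : Fin j) → lookup (unit i) i ≡ 1#
  lookup-unit zero = refl
  lookup-unit (suc i) = lookup-unit i

  lookup-unit-≢ : ∀ {j} {i i' : Fin j} → i ≢ i' → lookup (unit i) i' ≡ 0#
  lookup-unit-≢ {i = zero} {zero} i≢i' = ⊥-elim (i≢i' refl)
  lookup-unit-≢ {i = zero} {suc i'} _ = lookup-replicate i' 0#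
  lookup-unit-≢ {i = suc i} {zero} _ = refl
  lookup-unit-≢ {i = suc i} {suc i'} i≢i' = lookup-unit-≢ (i≢i' ∘ cong suc)

  allVecs-complete : ∀ {k} (v : Vec Carrier k) → v ∈ allVecs k
  allVecs-complete [] = here refl
  allVecs-complete {suc k} (x ∷ v) = ∈-concatMap⁺ (λ y → map (y ∷_) (allVecs k)) (lose (complete x) (∈-map⁺ (x ∷_) (allVecs-complete v)))

  allVecs-unique : ∀ k → Unique (allVecs k)
  allVecs-unique zero = [] ∷ []
  allVecs-unique (suc k) =
    Unique-concatMap (λ x → map (x ∷_) (allVecs k)) unique
      (λ _ → map⁺ ∷-injectiveʳ (allVecs-unique k)) same-head
    where
    same-head : ∀ {x x' w} → x ∈ elements → x' ∈ elements → w ∈ map (x ∷_) (allVecs k) → w ∈ map (x' ∷_) (allVecs k) → x ≡ x'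
    same-head _ _ w∈ w∈' with ∈-map⁻ _ w∈ | ∈-map⁻ _ w∈'
    ... | _ , _ , refl | _ , _ , eq = ∷-injectiveˡ eq

  lincomb⇒inSpan : ∀ {j} (us : Vec Vec5 j) (a : Vec Carrier j) {x} → lincomb a us ≡ x → inSpan us x ≡ true
  lincomb⇒inSpan us a eq = Equivalence.to T-≡ (any⁺ _ (lose (allVecs-complete a) (fromWitness eq)))

  inSpan⇒lincomb : ∀ {j} (us : Vec Vec5 j) {x} → inSpan us x ≡ true → ∃[ a ] lincomb a us ≡ x
  inSpan⇒lincomb {j} us x∈span with find (any⁻ _ (allVecs j) (Equivalence.from T-≡ x∈span))
  ... | a , _ , eq = a , toWitness eq

  inSpan-lookup : ∀ {j} (us : Vec Vec5 j) i → inSpan us (lookup us i) ≡ true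
  inSpan-lookup us i = lincomb⇒inSpan us (unit i) (lincomb-unit i us)

  inSpan-∷ : ∀ {j} u (us : Vec Vec5 j) {x} → inSpan us x ≡ true → inSpan (u ∷ us) x ≡ true
  inSpan-∷ u us x∈span with inSpan⇒lincomb us x∈span
  ... | a , eq = lincomb⇒inSpan (u ∷ us) (0# ∷ a) (trans (cong₂ _+v_ (·-zeroˡ u) eq) (+v-identityˡ _))

  ·-inverse : ∀ {k} {a} (a≢0 : a ≢ 0#) {u v : Vec Carrier k} → a · u ≡ v → u ≡ proj₁ (inverse a a≢0) · v
  ·-inverse {a = a} a≢0 {u} {v} a·u≡v = begin
    u                   ≡⟨ sym (·-identityˡ u) ⟩
    1# · u              ≡⟨ cong (_· u) (sym (trans (*-comm a⁻¹ a) (proj₂ (inverse a a≢0)))) ⟩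
    (a⁻¹ * a) · u       ≡⟨ sym (·-assoc a⁻¹ a u) ⟩
    a⁻¹ · (a · u)       ≡⟨ cong (a⁻¹ ·_) a·u≡v ⟩
    a⁻¹ · v             ∎
    where
    a⁻¹ = proj₁ (inverse a a≢0)

  independent-[] : LinearlyIndependent []
  independent-[] [] _ = refl

  independent-∷ : ∀ {j} {v} {us : Vec Vec5 j} → LinearlyIndependent us → inSpan us v ≢ true →
    LinearlyIndependent (v ∷ us)
  independent-∷ {v = v} {us} independent v∉span (b ∷ a) b·v+a·us≡0 with b ≟ 0#
  ... | yes refl = cong (0# ∷_) (independent a (begin
    lincomb a us                    ≡⟨ sym (+v-identityˡ _) ⟩
    zeroV +v lincomb a us           ≡⟨ cong (_+v lincomb a us) (sym (·-zeroˡ v)) ⟩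
    (0# · v) +v lincomb a us        ≡⟨ b·v+a·us≡0 ⟩
    zeroV                           ∎))
  ... | no b≢0 = ⊥-elim (v∉span (lincomb⇒inSpan us ((b⁻¹ * (- 1#)) · a) (begin
    lincomb ((b⁻¹ * (- 1#)) · a) us     ≡⟨ lincomb-· _ a us ⟩
    (b⁻¹ * (- 1#)) · lincomb a us       ≡⟨ sym (·-assoc b⁻¹ (- 1#) _) ⟩
    b⁻¹ · ((- 1#) · lincomb a us)       ≡⟨ sym (·-inverse b≢0 (+v-≡0⇒≡-neg (b · v) _ b·v+a·us≡0)) ⟩
    v                                   ∎)))
    where
    b⁻¹ = proj₁ (inverse b b≢0)

  lincomb-injective : ∀ {j} {us : Vec Vec5 j} → LinearlyIndependent us →
    ∀ a b → lincomb a us ≡ lincomb b us → a ≡ b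
  lincomb-injective {us = us} independent a b a·us≡b·us = +v-neg-≡0⇒≡ a b (independent _ (begin
    lincomb (a +v ((- 1#) · b)) us              ≡⟨ lincomb-+ a _ us ⟩
    lincomb a us +v lincomb ((- 1#) · b) us     ≡⟨ cong₂ _+v_ a·us≡b·us (lincomb-· (- 1#) b us) ⟩
    lincomb b us +v ((- 1#) · lincomb b us)     ≡⟨ +v-inverseʳ _ ⟩
    zeroV                                       ∎))

  normalised-∷ : ∀ {k} {x} {xs : Vec Carrier k} → isNormalised (x ∷ xs) ≡ true →
    (x ≡ 0# × isNormalised xs ≡ true) ⊎ (x ≢ 0# × x ≡ 1#)
  normalised-∷ {x = x} normalised with x ≟ 0#
  ... | yes x≡0 = inj₁ (x≡0 , normalised)
  ... | no x≢0  = inj₂ (x≢0 , toWitness (Equivalence.from T-≡ normalised))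

  normalised⇒≢0 : ∀ {k} {u : Vec Carrier k} → isNormalised u ≡ true → u ≢ zeroV
  normalised⇒≢0 {u = x ∷ u} normalised u≡0 with normalised-∷ {xs = u} normalised
  ... | inj₁ (_ , normalised′) = normalised⇒≢0 normalised′ (∷-injectiveʳ u≡0)
  ... | inj₂ (x≢0 , _)         = x≢0 (∷-injectiveˡ u≡0)

  normalised-proportional : ∀ {k} c {u v : Vec Carrier k} →
    isNormalised u ≡ true → isNormalised v ≡ true → u ≡ c · v → u ≡ v
  normalised-proportional c {x ∷ u} {y ∷ v} nu nv u≡c·v
    with normalised-∷ {xs = u} nu | normalised-∷ {xs = v} nv | ∷-injectiveˡ u≡c·v
  ... | inj₁ (x≡0 , nu′) | inj₁ (y≡0 , nv′) | _ =
    cong₂ _∷_ (trans x≡0 (sym y≡0)) (normalised-proportional c nu′ nv′ (∷-injectiveʳ u≡c·v))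
  ... | inj₂ (x≢0 , _) | inj₁ (refl , _) | x≡c*0 = ⊥-elim (x≢0 (trans x≡c*0 (zeroʳ c)))
  ... | inj₁ (refl , _) | inj₂ (_ , refl) | 0≡c*1 =
    ⊥-elim (normalised⇒≢0 nu (trans u≡c·v (trans (cong (_· (1# ∷ v)) c≡0) (·-zeroˡ _))))
    where
    c≡0 : c ≡ 0#
    c≡0 = sym (trans 0≡c*1 (*-identityʳ c))
  ... | inj₂ (_ , refl) | inj₂ (_ , refl) | 1≡c*1 =
    trans u≡c·v (trans (cong (_· (1# ∷ v)) c≡1) (·-identityˡ _))
    where
    c≡1 : c ≡ 1#
    c≡1 = sym (trans 1≡c*1 (*-identityʳ c))

  span-singleton-points-≡ : ∀ {w z z'} → isPoint z ≡ true → isPoint z' ≡ true →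
    inSpan (w ∷ []) z ≡ true → inSpan (w ∷ []) z' ≡ true → z ≡ z'
  span-singleton-points-≡ {w} {z} {z'} z-point z'-point z∈span z'∈span
    with inSpan⇒lincomb (w ∷ []) z∈span | inSpan⇒lincomb (w ∷ []) z'∈span
  ... | γ ∷ [] , γw≡z | γ' ∷ [] , γ'w≡z' = sym (normalised-proportional (γ' * γ⁻¹) z'-point z-point (begin
    z'                      ≡⟨ sym γ'w≡z' ⟩
    (γ' · w) +v zeroV       ≡⟨ +v-identityʳ _ ⟩
    γ' · w                  ≡⟨ cong (γ' ·_) (·-inverse γ≢0 (trans (sym (+v-identityʳ _)) γw≡z)) ⟩
    γ' · (γ⁻¹ · z)          ≡⟨ ·-assoc γ' γ⁻¹ z ⟩
    (γ' * γ⁻¹) · z          ∎))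
    where
    γ≢0 : γ ≢ 0#
    γ≢0 refl = normalised⇒≢0 z-point (trans (sym γw≡z) (trans (+v-identityʳ _) (·-zeroˡ w)))
    γ⁻¹ = proj₁ (inverse γ γ≢0)

  on-line⇒∈affine-span : ∀ {P y₀ z} → isPoint P ≡ true → isPoint z ≡ true → z ≢ P →
    inSpan (P ∷ y₀ ∷ []) z ≡ true → ∃[ a ] inSpan (((a · P) +v y₀) ∷ []) z ≡ true
  on-line⇒∈affine-span {P} {y₀} {z} P-point z-point z≢P z∈line
    with inSpan⇒lincomb (P ∷ y₀ ∷ []) z∈line
  ... | α ∷ β ∷ [] , eq = β⁻¹ * α , lincomb⇒inSpan _ (β ∷ []) (begin
    (β · (((β⁻¹ * α) · P) +v y₀)) +v zeroV        ≡⟨ +v-identityʳ _ ⟩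
    β · (((β⁻¹ * α) · P) +v y₀)                  ≡⟨ ·-distribˡ-+v β _ y₀ ⟩
    (β · ((β⁻¹ * α) · P)) +v (β · y₀)          ≡⟨ cong (_+v (β · y₀)) (·-assoc β _ P) ⟩
    ((β * (β⁻¹ * α)) · P) +v (β · y₀)          ≡⟨ cong (λ c → (c · P) +v (β · y₀)) β*β⁻¹*α≡α ⟩
    (α · P) +v (β · y₀)                        ≡⟨ sym (lincomb-pair α β P y₀) ⟩
    lincomb (α ∷ β ∷ []) (P ∷ y₀ ∷ [])          ≡⟨ eq ⟩
    z                                          ∎)
    where
    β≢0 : β ≢ 0#
    β≢0 refl = z≢P (normalised-proportional α z-point P-point (begin
      z                              ≡⟨ sym eq ⟩
      lincomb (α ∷ 0# ∷ []) (P ∷ y₀ ∷ [])  ≡⟨ lincomb-pair α 0# P y₀ ⟩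
      (α · P) +v (0# · y₀)           ≡⟨ cong ((α · P) +v_) (·-zeroˡ y₀) ⟩
      (α · P) +v zeroV               ≡⟨ +v-identityʳ _ ⟩
      α · P                          ∎))
    β⁻¹ = proj₁ (inverse β β≢0)
    β*β⁻¹*α≡α : β * (β⁻¹ * α) ≡ α
    β*β⁻¹*α≡α = trans (sym (*-assoc β β⁻¹ α)) (trans (cong (_* α) (proj₂ (inverse β β≢0))) (*-identityˡ α))

  -- Each such z is proportional to a · P + y₀ for exactly one scalar a.
  length-points-on-line-≤ : ∀ {P y₀} → isPoint P ≡ true → (zs : List Vec5) → Unique zs →
    (∀ {z} → z ∈ zs → isPoint z ≡ true × inSpan (P ∷ y₀ ∷ []) z ≡ true × z ≢ P) →
    length zs ≤ order
  length-points-on-line-≤ {P} {y₀} P-point zs unique on-line =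
    length-≤-of-injective-relation _≟_ (λ z a → inSpan (((a · P) +v y₀) ∷ []) z ≡ true) unique
      (λ z∈zs → let (z-point , z∈line , z≢P) = on-line z∈zs
                    (a , z∈span) = on-line⇒∈affine-span P-point z-point z≢P z∈line
                in a , complete a , z∈span)
      (λ z∈zs z'∈zs z∈span z'∈span →
        span-singleton-points-≡ (proj₁ (on-line z∈zs)) (proj₁ (on-line z'∈zs)) z∈span z'∈span)

  inSpan-pair⇒ : ∀ {u v w} → inSpan (u ∷ v ∷ []) w ≡ true → ∃[ α ] ∃[ β ] (α · u) +v (β · v) ≡ w
  inSpan-pair⇒ {u} {v} w∈line with inSpan⇒lincomb (u ∷ v ∷ []) w∈line
  ... | α ∷ β ∷ [] , eq = α , β , trans (sym (lincomb-pair α β u v)) eq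

  inSpan-line : ∀ {j} (us : Vec Vec5 j) {u v w} → inSpan us u ≡ true → inSpan us v ≡ true →
    inSpan (u ∷ v ∷ []) w ≡ true → inSpan us w ≡ true
  inSpan-line us u∈span v∈span w∈line
    with inSpan⇒lincomb us u∈span | inSpan⇒lincomb us v∈span | inSpan-pair⇒ w∈line
  ... | a , refl | b , refl | α , β , eq =
    lincomb⇒inSpan us ((α · a) +v (β · b)) (trans (lincomb-combination α β a b us) eq)

  module Frame {k} (B : Vec Vec5 k) (independent : LinearlyIndependent B) where

    InHyperplane : Fin k → Vec5 → Set
    InHyperplane j u = ∃[ c ] lincomb c B ≡ u × lookup c j ≡ 0#

    lookup-combination : ∀ α β (a b : Vec Carrier k) j →
      lookup ((α · a) +v (β · b)) j ≡ (α * lookup a j) + (β * lookup b j)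
    lookup-combination α β a b j = trans (lookup-zipWith _+_ j (α · a) (β · b))
      (cong₂ _+_ (lookup-map j (α *_) a) (lookup-map j (β *_) b))

    lincomb-unit-combination : ∀ α β i c →
      lincomb ((α · unit i) +v (β · c)) B ≡ (α · lookup B i) +v (β · lincomb c B)
    lincomb-unit-combination α β i c =
      trans (lincomb-combination α β (unit i) c B) (cong (λ v → (α · v) +v (β · lincomb c B)) (lincomb-unit i B))

    basis-∈-hyperplane : ∀ {i j} → i ≢ j → InHyperplane j (lookup B i)
    basis-∈-hyperplane {i} i≢j = unit i , lincomb-unit i B , lookup-unit-≢ i≢j

    line-∈-hyperplane : ∀ {i j u w} → i ≢ j → InHyperplane j u →
      inSpan (lookup B i ∷ u ∷ []) w ≡ true → InHyperplane j w
    line-∈-hyperplane {i} {j} i≢j (c , refl , cⱼ≡0) w∈line with inSpan-pair⇒ w∈line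
    ... | α , β , eq = (α · unit i) +v (β · c) , trans (lincomb-unit-combination α β i c) eq , (begin
      lookup ((α · unit i) +v (β · c)) j          ≡⟨ lookup-combination α β (unit i) c j ⟩
      (α * lookup (unit i) j) + (β * lookup c j)  ≡⟨ cong₂ (λ x y → (α * x) + (β * y)) (lookup-unit-≢ i≢j) cⱼ≡0 ⟩
      (α * 0#) + (β * 0#)                         ≡⟨ cong₂ _+_ (zeroʳ α) (zeroʳ β) ⟩
      0# + 0#                                     ≡⟨ +-identityʳ 0# ⟩
      0#                                          ∎)

    hyperplane-meets-line-once : ∀ {j u u'} → isPoint u ≡ true → isPoint u' ≡ true →
      InHyperplane j u → InHyperplane j u' → inSpan (lookup B j ∷ u ∷ []) u' ≡ true → u' ≡ u
    hyperplane-meets-line-once {j} u-point u'-point (c , refl , cⱼ≡0) (c' , refl , c'ⱼ≡0) u'∈line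
      with inSpan-pair⇒ u'∈line
    ... | α , β , eq = normalised-proportional β u'-point u-point (begin
      lincomb c' B                                ≡⟨ sym eq ⟩
      (α · lookup B j) +v (β · lincomb c B)       ≡⟨ cong (λ a → (a · lookup B j) +v (β · lincomb c B)) α≡0 ⟩
      (0# · lookup B j) +v (β · lincomb c B)      ≡⟨ cong (_+v (β · lincomb c B)) (·-zeroˡ _) ⟩
      zeroV +v (β · lincomb c B)                  ≡⟨ +v-identityˡ _ ⟩
      β · lincomb c B                             ∎)
      where
      coordinates : (α · unit j) +v (β · c) ≡ c'
      coordinates = lincomb-injective independent _ _ (trans (lincomb-unit-combination α β j c) eq)
      α≡0 : α ≡ 0#
      α≡0 = begin
        α                                           ≡⟨ sym (+-identityʳ α) ⟩
        α + 0#                                      ≡⟨ cong₂ _+_ (sym (*-identityʳ α)) (sym (zeroʳ β)) ⟩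
        (α * 1#) + (β * 0#)                         ≡⟨ cong₂ (λ x y → (α * x) + (β * y)) (sym (lookup-unit j)) (sym cⱼ≡0) ⟩
        (α * lookup (unit j) j) + (β * lookup c j)  ≡⟨ sym (lookup-combination α β (unit j) c j) ⟩
        lookup ((α · unit j) +v (β · c)) j          ≡⟨ cong (λ v → lookup v j) coordinates ⟩
        lookup c' j                                 ≡⟨ c'ⱼ≡0 ⟩
        0#                                          ∎

  _≟L_ : DecidableEquality (List Bool)
  _≟L_ = ≡-dec Bool._≟_

  points-unique : Unique points
  points-unique = filter⁺ (T? ∘ isPoint) (allVecs-unique 5)

  ∈points⇒isPoint : ∀ {x} → x ∈ points → isPoint x ≡ true
  ∈points⇒isPoint {x} x∈points = proj₂ (∈-filterᵇ⁻ isPoint {xs = allVecs 5} x∈points)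

  lineSet-≡⇒on-line : ∀ P {u v} → u ∈ points → lineSet P u ≡ lineSet P v → inSpan (P ∷ v ∷ []) u ≡ true
  lineSet-≡⇒on-line P {u} {v} u∈points eq =
    trans (sym (map-≡⇒≡ (inSpan (P ∷ u ∷ [])) (inSpan (P ∷ v ∷ [])) eq u∈points)) (inSpan-lookup (P ∷ u ∷ []) (suc zero))

module Configuration (F : FiniteField) (M : PG.Vec5 F → Bool) (P₁ P₂ P₃ : PG.Vec5 F)
  (P₁-point : PG.isPoint F P₁ ≡ true) (P₂-point : PG.isPoint F P₂ ≡ true) (P₃-point : PG.isPoint F P₃ ≡ true)
  (non-collinear : ¬ PG.Collinear F P₁ P₂ P₃)
  (π∩M≡∅ : ∀ x → PG.isPoint F x ≡ true → M x ≡ true → ¬ (PG.inSpan F (P₁ ∷ P₂ ∷ P₃ ∷ []) x ≡ true)) where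

  open import Data.Bool using (_∧_)
  open import Data.Bool.Properties using (T-≡)
  open import Data.Nat as ℕ using (ℕ; zero; suc)
  import Data.Nat.Properties as ℕ
  open import Data.Nat.Solver using (module +-*-Solver)
  open +-*-Solver using (solve; _:+_; _:*_; _:=_)
  open import Data.Fin using (Fin; zero; suc)
  open import Data.Vec using (Vec; lookup)
  import Data.Vec.Properties as Vec
  open import Data.List using (List; length; filterᵇ; concatMap)
  open import Data.List.Membership.Propositional using (_∈_; find)
  open import Data.List.Membership.Propositional.Properties using (∈-deduplicate⁺; ∈-map⁺; ∈-concatMap⁻)
  open import Data.List.Relation.Unary.Unique.Propositional using (Unique)
  open import Data.List.Relation.Unary.Unique.Propositional.Properties using (filter⁺)
  open import Data.Product using (Σ; ∃-syntax; _×_; _,_; proj₁; proj₂)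
  open import Function using (_∘_; id; Equivalence)
  open import Relation.Nullary.Decidable using (T?; fromWitnessFalse)
  open import Relation.Binary.PropositionalEquality using (_≢_; refl; sym; subst; cong₂)
  open ListCounting
  open RationalArithmetic using (∃-bracketing-multiple)

  open FiniteField F using (Carrier; _≟_; order)
  open PG F
  open ProjectiveSpace F

  π : Vec Vec5 3
  π = P₁ ∷ P₂ ∷ P₃ ∷ []

  π-independent : LinearlyIndependent π
  π-independent = independent-∷ (independent-∷ (independent-∷ independent-[] P₃∉⟨⟩) P₂∉⟨P₃⟩) P₁∉⟨P₂,P₃⟩
    where
    P₃∉⟨⟩ : inSpan [] P₃ ≢ true
    P₃∉⟨⟩ P₃∈⟨⟩ with inSpan⇒lincomb [] P₃∈⟨⟩
    ... | [] , 0≡P₃ = normalised⇒≢0 P₃-point (sym 0≡P₃)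
    P₂∉⟨P₃⟩ : inSpan (P₃ ∷ []) P₂ ≢ true
    P₂∉⟨P₃⟩ P₂∈⟨P₃⟩ = non-collinear (P₁ ∷ P₃ ∷ [] ,
      inSpan-lookup _ zero , inSpan-∷ P₁ _ P₂∈⟨P₃⟩ , inSpan-lookup _ (suc zero))
    P₁∉⟨P₂,P₃⟩ : inSpan (P₂ ∷ P₃ ∷ []) P₁ ≢ true
    P₁∉⟨P₂,P₃⟩ P₁∈⟨P₂,P₃⟩ = non-collinear (P₂ ∷ P₃ ∷ [] ,
      P₁∈⟨P₂,P₃⟩ , inSpan-lookup _ zero , inSpan-lookup _ (suc zero))

  MPoints : List Vec5
  MPoints = filterᵇ M points

  MPoints-unique : Unique MPoints
  MPoints-unique = filter⁺ (T? ∘ M) points-unique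

  ∈MPoints⁻ : ∀ {x} → x ∈ MPoints → x ∈ points × M x ≡ true
  ∈MPoints⁻ = ∈-filterᵇ⁻ M {xs = points}

  ∈π⇒∉M : ∀ i → M (lookup π i) ≢ true
  ∈π⇒∉M i M[πᵢ] = π∩M≡∅ (lookup π i) (πᵢ-point i) M[πᵢ] (inSpan-lookup π i)
    where
    πᵢ-point : ∀ i → isPoint (lookup π i) ≡ true
    πᵢ-point zero = P₁-point
    πᵢ-point (suc zero) = P₂-point
    πᵢ-point (suc (suc zero)) = P₃-point

  ∈MPoints⇒isPoint : ∀ {u} → u ∈ MPoints → isPoint u ≡ true
  ∈MPoints⇒isPoint = ∈points⇒isPoint ∘ proj₁ ∘ ∈MPoints⁻

  lineSet∈linesThroughMeeting : ∀ {P x} → M P ≢ true → x ∈ MPoints → lineSet P x ∈ linesThroughMeeting P M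
  lineSet∈linesThroughMeeting {P} {x} P∉M x∈M with ∈MPoints⁻ x∈M
  ... | x∈points , Mx = ∈-deduplicate⁺ _≟L_ (∈-map⁺ (lineSet P) (∈-filterᵇ⁺ _ x∈points
    (cong₂ _∧_ Mx (Equivalence.to T-≡ (fromWitnessFalse x≢P)))))
    where
    x≢P : x ≢ P
    x≢P refl = P∉M Mx

  on-line-of-fibre : ∀ P {Xs x y} → (∀ {z} → z ∈ Xs → z ∈ MPoints) →
    y ∈ fibre _≟L_ (lineSet P) Xs (lineSet P x) → y ∈ Xs × inSpan (P ∷ x ∷ []) y ≡ true
  on-line-of-fibre P {Xs} {x} Xs⊆M y∈fibre with ∈-fibre⁻ _≟L_ (lineSet P) {Xs} y∈fibre
  ... | y∈Xs , eq = y∈Xs , lineSet-≡⇒on-line P (proj₁ (∈MPoints⁻ (Xs⊆M y∈Xs))) eq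

  #M≤#lines*order : ∀ {P} → isPoint P ≡ true → M P ≢ true → #M M ℕ.≤ #linesThroughMeeting P M ℕ.* order
  #M≤#lines*order {P} P-point P∉M =
    length-≤-keys*fibre _≟L_ (lineSet P) (linesThroughMeeting P M) order (lineSet∈linesThroughMeeting P∉M)
      (λ {x} _ → length-points-on-line-≤ P-point _ (filter⁺ _ MPoints-unique) (on-line-≢P x))
    where
    on-line-≢P : ∀ x {z} → z ∈ fibre _≟L_ (lineSet P) MPoints (lineSet P x) →
      isPoint z ≡ true × inSpan (P ∷ x ∷ []) z ≡ true × z ≢ P
    on-line-≢P x z∈fibre with on-line-of-fibre P id z∈fibre
    ... | z∈M , z∈line with ∈MPoints⁻ z∈M
    ...   | z∈points , Mz = ∈points⇒isPoint z∈points , z∈line , λ { refl → P∉M Mz }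

  module Pruning (s : ℕ) where

    G₃ G₂ G₁ : List Vec5
    G₃ = rich _≟L_ (lineSet P₃) (suc s) MPoints
    G₂ = rich _≟L_ (lineSet P₂) (suc s) G₃
    G₁ = rich _≟L_ (lineSet P₁) (suc s) G₂

    G₃⊆M : ∀ {x} → x ∈ G₃ → x ∈ MPoints
    G₃⊆M = proj₁ ∘ ∈-rich⁻ _≟L_ (lineSet P₃) {xs = MPoints}

    G₂⊆G₃ : ∀ {x} → x ∈ G₂ → x ∈ G₃
    G₂⊆G₃ = proj₁ ∘ ∈-rich⁻ _≟L_ (lineSet P₂) {xs = G₃}

    G₁⊆G₂ : ∀ {x} → x ∈ G₁ → x ∈ G₂
    G₁⊆G₂ = proj₁ ∘ ∈-rich⁻ _≟L_ (lineSet P₁) {xs = G₂}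

    G₃-unique : Unique G₃
    G₃-unique = filter⁺ _ MPoints-unique

    G₂-unique : Unique G₂
    G₂-unique = filter⁺ _ G₃-unique

    #M≤#G₁+#lines*s : #M M ℕ.≤ length G₁ ℕ.+
      (#linesThroughMeeting P₁ M ℕ.+ (#linesThroughMeeting P₂ M ℕ.+ #linesThroughMeeting P₃ M)) ℕ.* s
    #M≤#G₁+#lines*s = begin
      length MPoints                                   ≤⟨ pruning-loss (suc (suc zero)) id ⟩
      length G₃ ℕ.+ L₃ ℕ.* s                           ≤⟨ ℕ.+-monoˡ-≤ _ (pruning-loss (suc zero) G₃⊆M) ⟩
      length G₂ ℕ.+ L₂ ℕ.* s ℕ.+ L₃ ℕ.* s              ≤⟨ ℕ.+-monoˡ-≤ _ (ℕ.+-monoˡ-≤ _ (pruning-loss zero (G₃⊆M ∘ G₂⊆G₃))) ⟩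
      length G₁ ℕ.+ L₁ ℕ.* s ℕ.+ L₂ ℕ.* s ℕ.+ L₃ ℕ.* s  ≡⟨ solve 5 (λ g l₁ l₂ l₃ s → g :+ l₁ :* s :+ l₂ :* s :+ l₃ :* s
                                                               := g :+ (l₁ :+ (l₂ :+ l₃)) :* s) refl (length G₁) L₁ L₂ L₃ s ⟩
      length G₁ ℕ.+ (L₁ ℕ.+ (L₂ ℕ.+ L₃)) ℕ.* s          ∎
      where
      open ℕ.≤-Reasoning
      L₁ = #linesThroughMeeting P₁ M
      L₂ = #linesThroughMeeting P₂ M
      L₃ = #linesThroughMeeting P₃ M
      pruning-loss : ∀ i {Xs} → (∀ {x} → x ∈ Xs → x ∈ MPoints) →
        length Xs ℕ.≤ length (rich _≟L_ (lineSet (lookup π i)) (suc s) Xs) ℕ.+ #linesThroughMeeting (lookup π i) M ℕ.* s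
      pruning-loss i {Xs} Xs⊆M = length-≤-rich+keys* _≟L_ (lineSet (lookup π i)) _ s Xs
        (lineSet∈linesThroughMeeting (∈π⇒∉M i) ∘ Xs⊆M)


    module _ {x : Vec5} (x∈G₁ : x ∈ G₁) where

      x∈M : x ∈ MPoints
      x∈M = G₃⊆M (G₂⊆G₃ (G₁⊆G₂ x∈G₁))

      B : Vec Vec5 4
      B = x ∷ π

      B-independent : LinearlyIndependent B
      B-independent = independent-∷ π-independent (π∩M≡∅ x (∈MPoints⇒isPoint x∈M) (proj₂ (∈MPoints⁻ x∈M)))

      open Frame B B-independent

      i₀ i₁ i₂ i₃ : Fin 4
      i₀ = zero
      i₁ = suc zero
      i₂ = suc (suc zero)
      i₃ = suc (suc (suc zero))

      Y : List Vec5
      Y = fibre _≟L_ (lineSet P₁) G₂ (lineSet P₁ x)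

      Z : Vec5 → List Vec5
      Z y = fibre _≟L_ (lineSet P₂) G₃ (lineSet P₂ y)

      W : Vec5 → List Vec5
      W z = fibre _≟L_ (lineSet P₃) MPoints (lineSet P₃ z)

      y∈Y⇒ : ∀ {y} → y ∈ Y → y ∈ G₂ × InHyperplane i₂ y × InHyperplane i₃ y
      y∈Y⇒ y∈Y =
        let y∈G₂ , y∈P₁x = on-line-of-fibre P₁ (G₃⊆M ∘ G₂⊆G₃) y∈Y
        in y∈G₂ , line-∈-hyperplane {i₁} {i₂} (λ ()) (basis-∈-hyperplane {i₀} (λ ())) y∈P₁x
                , line-∈-hyperplane {i₁} {i₃} (λ ()) (basis-∈-hyperplane {i₀} (λ ())) y∈P₁x

      z∈Z⇒ : ∀ {y z} → y ∈ Y → z ∈ Z y → z ∈ G₃ × InHyperplane i₃ z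
      z∈Z⇒ y∈Y z∈Zy =
        let z∈G₃ , z∈P₂y = on-line-of-fibre P₂ G₃⊆M z∈Zy
        in z∈G₃ , line-∈-hyperplane {i₂} {i₃} (λ ()) (proj₂ (proj₂ (y∈Y⇒ y∈Y))) z∈P₂y

      w∈W⇒ : ∀ {y z w} → y ∈ Y → z ∈ Z y → w ∈ W z → w ∈ MPoints × inSpan B w ≡ true
      w∈W⇒ y∈Y z∈Zy w∈Wz =
        let w∈M , w∈P₃z = on-line-of-fibre P₃ id w∈Wz
            c , c≡z , _ = proj₂ (z∈Z⇒ y∈Y z∈Zy)
        in w∈M , inSpan-line B (inSpan-lookup B i₃) (lincomb⇒inSpan B c c≡z) w∈P₃z

      same-line-in-hyperplane⇒≡ : ∀ j {u u'} → u ∈ MPoints → u' ∈ MPoints →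
        InHyperplane j u → InHyperplane j u' → lineSet (lookup B j) u ≡ lineSet (lookup B j) u' → u ≡ u'
      same-line-in-hyperplane⇒≡ j u∈M u'∈M u∈H u'∈H eq = hyperplane-meets-line-once (∈MPoints⇒isPoint u'∈M) (∈MPoints⇒isPoint u∈M) u'∈H u∈H
        (lineSet-≡⇒on-line (lookup B j) (proj₁ (∈MPoints⁻ u∈M)) eq)

      Z-separated : ∀ {y y' z} → y ∈ Y → y' ∈ Y → z ∈ Z y → z ∈ Z y' → y ≡ y'
      Z-separated y∈Y y'∈Y z∈Zy z∈Zy' =
        let y∈G₂ , y∈H₂ , _ = y∈Y⇒ y∈Y
            y'∈G₂ , y'∈H₂ , _ = y∈Y⇒ y'∈Y
        in same-line-in-hyperplane⇒≡ i₂ (G₃⊆M (G₂⊆G₃ y∈G₂)) (G₃⊆M (G₂⊆G₃ y'∈G₂)) y∈H₂ y'∈H₂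
             (fibres-disjoint _≟L_ (lineSet P₂) {G₃} {G₃} z∈Zy z∈Zy')

      W-separated : ∀ {y y' z z' w} → y ∈ Y → y' ∈ Y → z ∈ Z y → z' ∈ Z y' → w ∈ W z → w ∈ W z' → z ≡ z'
      W-separated y∈Y y'∈Y z∈Zy z'∈Zy' w∈Wz w∈Wz' =
        let z∈G₃ , z∈H₃ = z∈Z⇒ y∈Y z∈Zy
            z'∈G₃ , z'∈H₃ = z∈Z⇒ y'∈Y z'∈Zy'
        in same-line-in-hyperplane⇒≡ i₃ (G₃⊆M z∈G₃) (G₃⊆M z'∈G₃) z∈H₃ z'∈H₃
             (fibres-disjoint _≟L_ (lineSet P₃) {MPoints} {MPoints} w∈Wz w∈Wz')

      Reached : List Vec5
      Reached = concatMap (λ y → concatMap W (Z y)) Y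

      ∈Reached⁻ : ∀ {w} → w ∈ Reached → ∃[ y ] ∃[ z ] y ∈ Y × z ∈ Z y × w ∈ W z
      ∈Reached⁻ w∈Reached =
        let y , y∈Y , w∈Wy = find (∈-concatMap⁻ _ {xs = Y} w∈Reached)
            z , z∈Zy , w∈Wz = find (∈-concatMap⁻ W {xs = Z y} w∈Wy)
        in y , z , y∈Y , z∈Zy , w∈Wz

      Reached-unique : Unique Reached
      Reached-unique = Unique-concatMap _ (filter⁺ _ G₂-unique)
        (λ y∈Y → Unique-concatMap W (filter⁺ _ G₃-unique) (λ _ → filter⁺ _ MPoints-unique) (W-separated y∈Y y∈Y))
        Y-separated
        where
        Y-separated : ∀ {y y' w} → y ∈ Y → y' ∈ Y → w ∈ concatMap W (Z y) → w ∈ concatMap W (Z y') → y ≡ y'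
        Y-separated {y} {y'} y∈Y y'∈Y w∈Wy w∈Wy' =
          let z , z∈Zy , w∈Wz = find (∈-concatMap⁻ W {xs = Z y} w∈Wy)
              z' , z'∈Zy' , w∈Wz' = find (∈-concatMap⁻ W {xs = Z y'} w∈Wy')
              z≡z' = W-separated y∈Y y'∈Y z∈Zy z'∈Zy' w∈Wz w∈Wz'
          in Z-separated y∈Y y'∈Y z∈Zy (subst (_∈ Z y') (sym z≡z') z'∈Zy')

      suc-s³≤#Reached : suc s ℕ.* (suc s ℕ.* suc s) ℕ.≤ length Reached
      suc-s³≤#Reached = ℕ.≤-trans (ℕ.*-monoˡ-≤ _ (proj₂ (∈-rich⁻ _≟L_ (lineSet P₁) {xs = G₂} x∈G₁)))
        (length-concatMap-≥ _ _ Y λ y∈Y → ℕ.≤-trans (ℕ.*-monoˡ-≤ _ (#Z (proj₁ (y∈Y⇒ y∈Y))))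
          (length-concatMap-≥ W _ _ λ z∈Zy → #W (proj₁ (z∈Z⇒ y∈Y z∈Zy))))
        where
        #Z : ∀ {y} → y ∈ G₂ → suc s ℕ.≤ length (Z y)
        #Z = proj₂ ∘ ∈-rich⁻ _≟L_ (lineSet P₂) {xs = G₃}
        #W : ∀ {z} → z ∈ G₃ → suc s ℕ.≤ length (W z)
        #W = proj₂ ∘ ∈-rich⁻ _≟L_ (lineSet P₃) {xs = MPoints}

      solid : Solid
      solid = B , B-independent

      suc-s³≤#solid∩M : suc s ℕ.* (suc s ℕ.* suc s) ℕ.≤ #SolidMeet solid M
      suc-s³≤#solid∩M = ℕ.≤-trans suc-s³≤#Reached (Unique-⊆⇒length-≤ (Vec.≡-dec _≟_) Reached-unique Reached⊆solid∩M)
        where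
        Reached⊆solid∩M : ∀ {w} → w ∈ Reached → w ∈ filterᵇ (λ v → M v ∧ inSpan B v) points
        Reached⊆solid∩M w∈Reached =
          let _ , _ , y∈Y , z∈Zy , w∈Wz = ∈Reached⁻ w∈Reached
              w∈M , w∈B = w∈W⇒ y∈Y z∈Zy w∈Wz
              w∈points , Mw = ∈MPoints⁻ w∈M
          in ∈-filterᵇ⁺ _ w∈points (cong₂ _∧_ Mw w∈B)

  solid-through-π : (s : ℕ) →
    (#linesThroughMeeting P₁ M ℕ.+ (#linesThroughMeeting P₂ M ℕ.+ #linesThroughMeeting P₃ M)) ℕ.* s ℕ.< #M M →
    Σ Solid λ S → (inSpan (proj₁ S) P₁ ≡ true) × (inSpan (proj₁ S) P₂ ≡ true) × (inSpan (proj₁ S) P₃ ≡ true) ×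
      (suc s ℕ.* (suc s ℕ.* suc s) ℕ.≤ #SolidMeet S M)
  solid-through-π s L*s<N =
    let x , x∈G₁ = ∃-∈-of-length>0 (ℕ.+-cancelʳ-< _ 0 (length G₁) (ℕ.<-≤-trans L*s<N #M≤#G₁+#lines*s))
        B′ = B x∈G₁
    in solid x∈G₁ , inSpan-lookup B′ (suc zero) , inSpan-lookup B′ (suc (suc zero))
       , inSpan-lookup B′ (suc (suc (suc zero))) , suc-s³≤#solid∩M x∈G₁
    where
    open Pruning s

  ∃-rich-solid-through-π : 1 ℕ.≤ #M M → ∃[ t ]
    #M M ℕ.≤ (#linesThroughMeeting P₁ M ℕ.+ (#linesThroughMeeting P₂ M ℕ.+ #linesThroughMeeting P₃ M)) ℕ.* t ×
    Σ Solid λ S → (inSpan (proj₁ S) P₁ ≡ true) × (inSpan (proj₁ S) P₂ ≡ true) × (inSpan (proj₁ S) P₃ ≡ true) ×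
      (t ℕ.* (t ℕ.* t) ℕ.≤ #SolidMeet S M)
  ∃-rich-solid-through-π 1≤N =
    let L₁≢0 = ℕ.m*n≢0⇒m≢0 L₁ {{ℕ.>-nonZero (ℕ.≤-trans 1≤N (#M≤#lines*order P₁-point (∈π⇒∉M zero)))}}
        L≢0 = ℕ.>-nonZero (ℕ.<-≤-trans (ℕ.>-nonZero⁻¹ L₁ {{L₁≢0}}) (ℕ.m≤m+n L₁ _))
        s , L*s<N , N≤L*[1+s] = ∃-bracketing-multiple (#M M) _ {{L≢0}} 1≤N
    in suc s , N≤L*[1+s] , solid-through-π s L*s<N
    where
    L₁ = #linesThroughMeeting P₁ M

open RationalArithmetic
open import Data.Nat as ℕ using (ℕ)
open import Data.Fin using (zero)
open import Data.List using (_∷_; length)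
open import Data.Product using (Σ; _×_; _,_; proj₁)
open import Data.Rational using (ℚ; _≤_; _<_; _*_; Positive)
open import Data.Rational.Properties using (≤-trans; <⇒≤; pos*pos⇒pos)
open import Relation.Binary.PropositionalEquality using (refl; subst)

order-pos : (F : FiniteField) → Positive (ℕ→ℚ (FiniteField.order F))
order-pos F with FiniteField.elements F | FiniteField.complete F (FiniteField.0# F)
... | _ ∷ es | _ = ℕ→ℚ-pos (length es)

lemma4p1 : (q : ℕ) → IsPrimePower q → (F : FiniteField) → FiniteField.order F ≡ q →
    let open PG F in
    (M : Vec5 → Bool) → (P₁ P₂ P₃ : Vec5) →
    isPoint P₁ ≡ true → isPoint P₂ ≡ true → isPoint P₃ ≡ true →
    ¬ Collinear P₁ P₂ P₃ →
    (∀ x → isPoint x ≡ true → M x ≡ true → ¬ (inSpan (P₁ ∷ P₂ ∷ P₃ ∷ []) x ≡ true)) →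
    (m n d : ℚ) → Positive m → Positive n → Positive d →
    ℕ→ℚ (#linesThroughMeeting P₁ M) ≤ n * ℕ→ℚ q ^ℚ 2 →
    ℕ→ℚ (#linesThroughMeeting P₂ M) ≤ n * ℕ→ℚ q ^ℚ 2 →
    ℕ→ℚ (#linesThroughMeeting P₃ M) ≤ n * ℕ→ℚ q ^ℚ 2 →
    ℕ→ℚ (#M M) ≡ d * ℕ→ℚ q ^ℚ 3 →
    ℕ→ℚ 32 * n ^ℚ 5 * m < ℕ→ℚ q * d ^ℚ 5 →
    Σ Solid λ S →
      (inSpan (proj₁ S) P₁ ≡ true) ×
      (inSpan (proj₁ S) P₂ ≡ true) ×
      (inSpan (proj₁ S) P₃ ≡ true) ×
      (m * ℕ→ℚ q ^ℚ 2 ≤ ℕ→ℚ (#SolidMeet S M))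
lemma4p1 q _ F refl M P₁ P₂ P₃ P₁-point P₂-point P₃-point non-collinear π∩M≡∅
         m n d _ n>0 d>0 L₁≤nq² L₂≤nq² L₃≤nq² N≡dq³ 32n⁵m<qd⁵ =
  let t , N≤L*t , S , P₁∈S , P₂∈S , P₃∈S , t³≤#S∩M = ∃-rich-solid-through-π 1≤#M
      mq²<t³ = m*q²<t³ m n d Q (ℕ→ℚ t) (ℕ→ℚ-nonNeg t) d≤n (density*q≤3nt t N≤L*t) 32n⁵m<qd⁵
  in S , P₁∈S , P₂∈S , P₃∈S , ≤-trans (<⇒≤ mq²<t³) (subst (_≤ ℕ→ℚ (#SolidMeet S M)) (ℕ→ℚ-cube t) (ℕ→ℚ-mono-≤ t³≤#S∩M))
  where
  open PG F using (#M; #linesThroughMeeting; #SolidMeet)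
  open Configuration F M P₁ P₂ P₃ P₁-point P₂-point P₃-point non-collinear π∩M≡∅
  Q = ℕ→ℚ q
  instance
    _ = order-pos F
    _ = n>0
    _ = d>0
  open DensityBounds (#M M) (#linesThroughMeeting P₁ M) (#linesThroughMeeting P₂ M) (#linesThroughMeeting P₃ M)
    q n d N≡dq³ L₁≤nq² L₂≤nq² L₃≤nq²
  1≤#M : 1 ℕ.≤ #M M
  1≤#M = ℕ→ℚ≡pos⇒≥1 (#M M) _ {{pos*pos⇒pos d (Q ^ℚ 3) {{^ℚ-pos Q 3}}}} N≡dq³
  d≤n : d ≤ n
  d≤n = density≤n (#M≤#lines*order P₁-point (∈π⇒∉M zero))
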